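{- Let $g$ be a normalized arithmetic function and let $1\le m<n$ be integers. Let $A_{n,m}^{g,\mathrm{id}}$ be the coefficient of $x^m$ in $n!\,P_n^{g,\mathrm{id}}(x)$. Then $$A_{n,m}^{g,\mathrm{id}}=\sum_{\mu\vdash n-m}\mathcal{G}(\mu)\prod_{k=0}^{|\mu|+\ell(\mu)-1}(n-k)\sum_{\lambda\in\mathrm{Orb}(\mu)}\prod_{k=1}^{\ell(\lambda)}\Big(k+\sum_{i=1}^k\lambda_i\Big)^{ -1}.$$
   Context: An arithmetic function is a map $f:\mathbb{N}=\{1,2,\dots\}\to\mathbb{C}$; it is normalized if $f(1)=1$; $\mathrm{id}(n)=n$. For a normalized arithmetic function $g$ define $P_0^{g,\mathrm{id}}(x):=1$ and, for $n\ge1$, $P_n^{g,\mathrm{id}}(x):=\frac{x}{n}\sum_{k=1}^n g(k)P_{n-k}^{g,\mathrm{id}}(x)$. Write $n!\,P_n^{g,\mathrm{id}}(x)=\sum_{m=0}^nA^{g,\mathrm{id}}_{n,m}x^m$. For a partition $\mu=(\mu_1,\dots,\mu_r)$ (non-increasing positive integers), $\ell(\mu)=r$, $|\mu|=\sum\mu_i$, $\mathcal{G}(\mu):=\prod_{k=1}^r g(\mu_k+1)$, and $\mu\vdash N$ means $|\mu|=N$. $\mathrm{Orb}(\mu)$ is the set of distinct compositions (ordered sequences of positive integers) obtained by permuting the parts of $\mu$. -}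

module Defs where

open import Level using (Level)
open import Data.Nat as ℕ using (ℕ; zero; suc; _∸_)
open import Data.Nat.ListAction using (sum)
open import Data.Integer as ℤ using (ℤ; +_)
open import Data.Rational as ℚ using (ℚ)
open import Data.List using (List; []; _∷_; [_]; map; concatMap; upTo; filterᵇ; length; foldr; zipWith)
open import Data.Bool using (Bool; true; false; _∧_; if_then_else_)
open import Data.Maybe using (Maybe; just; nothing)
open import Algebra.Bundles using (CommutativeRing)

-- compsF fuel N : all compositions of N (lists of positive integers
-- summing to N), enumerated by first part; fuel ≥ N suffices since every
-- part is ≥ 1.
compsF : ℕ → ℕ → List (List ℕ)
compsF _ zero = [ [] ]
compsF zero (suc _) = []
compsF (suc f) (suc N) =
  concatMap (λ k → map (k ∷_) (compsF f (suc N ∸ k))) (map suc (upTo (suc N)))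

compositions : ℕ → List (List ℕ)
compositions N = compsF N N

nonIncreasing : List ℕ → Bool
nonIncreasing (a ∷ b ∷ t) = (b ℕ.≤ᵇ a) ∧ nonIncreasing (b ∷ t)
nonIncreasing _ = true

partitions : ℕ → List (List ℕ)
partitions N = filterᵇ nonIncreasing (compositions N)

removeOne : ℕ → List ℕ → Maybe (List ℕ)
removeOne x [] = nothing
removeOne x (y ∷ ys) with x ℕ.≡ᵇ y
... | true = just ys
... | false with removeOne x ys
...   | nothing = nothing
...   | just ys' = just (y ∷ ys')

isPermᵇ : List ℕ → List ℕ → Bool
isPermᵇ [] [] = true
isPermᵇ [] (_ ∷ _) = false
isPermᵇ (x ∷ xs) ys with removeOne x ys
... | nothing = false
... | just ys' = isPermᵇ xs ys'

Orb : List ℕ → List (List ℕ)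
Orb μ = filterᵇ (λ λ' → isPermᵇ λ' μ) (compositions (sum μ))

ℤtoℚ : ℤ → ℚ
ℤtoℚ z = z ℚ./ 1

fallingℤ : ℕ → ℕ → ℤ
fallingℤ n zero = + 1
fallingℤ n (suc L) = fallingℤ n L ℤ.* ((+ n) ℤ.- (+ L))

-- invProdFrom j s λ = ∏_k ((j+k) + (s + λ_1 + … + λ_k))^{-1}
invProdFrom : ℕ → ℕ → List ℕ → ℚ
invProdFrom j s [] = ℚ.1ℚ
invProdFrom j s (a ∷ t) = ((+ 1) ℚ./ (suc j ℕ.+ (s ℕ.+ a))) ℚ.* invProdFrom (suc j) (s ℕ.+ a) t

invProd : List ℕ → ℚ
invProd λ' = invProdFrom 0 0 λ'

sumℚ : List ℚ → ℚ
sumℚ = foldr ℚ._+_ ℚ.0ℚ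

-- Ring-valued part, over a commutative ring R with a map ι : ℚ → R
-- (in the statement ι is required to be a ring homomorphism, i.e. R is a
-- ℚ-algebra, e.g. ℂ).

module _ {c ℓ : Level} (R : CommutativeRing c ℓ) (ι : ℚ → CommutativeRing.Carrier R) where
  open CommutativeRing R

  sumR : List Carrier → Carrier
  sumR = foldr _+_ 0#

  prodR : List Carrier → Carrier
  prodR = foldr _*_ 1#

  -- Polynomials are represented by coefficient functions ℕ → R.
  -- table g n = [P_n, P_{n-1}, …, P_0], where P_k are the polynomials
  -- P_0 = 1,  P_n(x) = (x/n) Σ_{k=1}^n g(k) P_{n-k}(x).
  table : (ℕ → Carrier) → ℕ → List (ℕ → Carrier)
  table g zero = (λ { zero → 1# ; (suc _) → 0# }) ∷ []
  table g (suc n) = next ∷ table g n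
    where
      next : ℕ → Carrier
      next zero = 0#
      next (suc m) = ι ((+ 1) ℚ./ suc n) *
        sumR (zipWith (λ k p → g k * p m) (map suc (upTo (suc n))) (table g n))

  Pcoeff : (ℕ → Carrier) → ℕ → ℕ → Carrier
  Pcoeff g n with table g n
  ... | [] = λ _ → 0#
  ... | p ∷ _ = p

  A : (ℕ → Carrier) → ℕ → ℕ → Carrier
  A g n m = ι ((+ (n ℕ.!)) ℚ./ 1) * Pcoeff g n m

  𝒢 : (ℕ → Carrier) → List ℕ → Carrier
  𝒢 g μ = prodR (map (λ a → g (a ℕ.+ 1)) μ)

  RHS : (ℕ → Carrier) → ℕ → ℕ → Carrier
  RHS g n m = sumR (map (λ μ →
      𝒢 g μ * ι (ℤtoℚ (fallingℤ n (sum μ ℕ.+ length μ)) ℚ.* sumℚ (map invProd (Orb μ))))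
    (partitions (n ∸ m)))

{-# OPTIONS --safe #-}
-- Write P(n, m) for the coefficient of xᵐ in Pₙ, so that (n + 1) P(n + 1, m + 1) = Σᵢ g(i + 1) P(n − i, m).
-- By induction on m,
--   P(N + m, m) = Σ_{λ ⊨ N} 𝒢(λ) (m − ℓ(λ))!⁻¹ ∏ₖ (k + λ₁ + … + λₖ)⁻¹,
-- summed over all compositions λ of N.  In the inductive step the factor N + m + 1 is split as
-- (m + 1 − ℓ(λ)) + (|λ| + ℓ(λ)): the first summand lowers the factorial, the second cancels the last
-- factor of the product, and stripping off the last part of λ then reproduces the recursion.
-- Multiplying by n! turns (m − ℓ(λ))!⁻¹ into the falling factorial n (n − 1) ⋯ (n − |λ| − ℓ(λ) + 1).
-- That factor and 𝒢 depend only on the multiset of parts of λ, so grouping compositions by their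
-- sorted rearrangement gives the sum over partitions μ and orbits Orb(μ).
module Submission where

open import Defs
open import Level using (Level)
open import Data.Nat as ℕ using (ℕ; zero; suc; _∸_; _≤_; _<_; z≤n; s≤s; _≤ᵇ_; _≡ᵇ_; _!)
import Data.Nat.Properties as ℕP
open import Data.Nat.ListAction using (sum)
open import Data.Nat.ListAction.Properties using (sum-++; sum-↭)
open import Data.Nat.Combinatorics.Base using (_P′_)
open import Data.Nat.Combinatorics.Specification using (nP′k≡n!/[n∸k]!)
open import Data.Nat.Divisibility using (m≤n⇒m!∣n!)
open import Data.Nat.DivMod using (m/n*n≡m)
import Algebra.Properties.CommutativeSemigroup ℕP.+-commutativeSemigroup as ℕ+
open import Data.Integer as ℤ using (+_)
import Data.Integer.Properties as ℤP
open import Data.Integer.Tactic.RingSolver using (solve-∀)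
open import Data.Rational as ℚ using (ℚ)
import Data.Rational.Properties as ℚP
open import Data.Rational.Base using (+-*-rawRing)
import Data.Rational.Unnormalised as ℚᵘ
import Data.Rational.Unnormalised.Properties as ℚᵘP
open import Data.Bool using (Bool; true; false; _∧_; T; if_then_else_)
open import Data.Bool.Properties using (T-∧)
open import Data.Unit using (tt)
open import Data.Empty using (⊥; ⊥-elim)
open import Data.Maybe using (just; nothing)
open import Data.Sum using (inj₁; inj₂)
open import Data.Product using (_×_; _,_; proj₁)
open import Data.List using (List; []; _∷_; [_]; _++_; length; map; concatMap; applyUpTo; upTo; filterᵇ; foldr; zipWith; reverse)
open import Data.List.Properties using (length-++; unfold-reverse; reverse-involutive)
open import Data.List.Membership.Propositional using (_∉_)
open import Data.List.Relation.Unary.Any using (here; there)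
open import Data.List.Relation.Unary.All using (All; []; _∷_)
open import Data.List.Relation.Unary.Linked using ([]; [-]; _∷_)
open import Data.List.Relation.Binary.Pointwise using (Pointwise-≡⇒≡)
open import Data.List.Relation.Binary.Permutation.Propositional
  using (_↭_; ↭-refl; ↭-sym; ↭-trans; ↭-prep; ↭-swap; ↭⇒↭ₛ; ↭⇒↭ₛ′)
open import Data.List.Relation.Binary.Permutation.Propositional.Properties
  using (All-resp-↭; ∈-resp-↭; ↭-empty-inv; drop-∷; ↭-reverse; ↭-length; map⁺)
open import Relation.Binary.Bundles using (DecTotalOrder)
open import Relation.Binary.Properties.DecTotalOrder ℕP.≤-decTotalOrder using (≥-decTotalOrder)
open import Data.List.Sort ≥-decTotalOrder using (sort; sort-↭; sort-↗)
open import Data.List.Relation.Unary.Sorted.TotalOrder (DecTotalOrder.totalOrder ≥-decTotalOrder) using (Sorted)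
open import Data.List.Relation.Unary.Sorted.TotalOrder.Properties using (↗↭↗⇒≋)
open import Algebra.Bundles using (CommutativeSemiring; CommutativeRing)
open import Algebra.Morphism.Structures using (module RingMorphisms)
open import Function using (_∘_; id; Equivalence)
open import Relation.Binary.Definitions using (tri<; tri≈; tri>)
open import Relation.Binary.PropositionalEquality as ≡ using (_≡_; _≢_)

1+[n/1]≡[1+n]/1 : ∀ n → ℚ.1ℚ ℚ.+ (+ n ℚ./ 1) ≡ + suc n ℚ./ 1
1+[n/1]≡[1+n]/1 n = ℚP.toℚᵘ-injective (begin
  ℚ.toℚᵘ (ℚ.1ℚ ℚ.+ (+ n ℚ./ 1))
    ≈⟨ ℚP.toℚᵘ-homo-+ ℚ.1ℚ (+ n ℚ./ 1) ⟩
  ℚ.toℚᵘ ℚ.1ℚ ℚᵘ.+ ℚ.toℚᵘ (+ n ℚ./ 1)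
    ≈⟨ ℚᵘP.+-cong (ℚP.toℚᵘ-fromℚᵘ ℚᵘ.1ℚᵘ) (ℚP.toℚᵘ-fromℚᵘ (+ n ℚᵘ./ 1)) ⟩
  ℚᵘ.1ℚᵘ ℚᵘ.+ (+ n ℚᵘ./ 1)
    ≈⟨ ℚᵘ.*≡* (cross-multiplied (+ n)) ⟩
  + suc n ℚᵘ./ 1
    ≈⟨ ℚP.toℚᵘ-fromℚᵘ (+ suc n ℚᵘ./ 1) ⟨
  ℚ.toℚᵘ (+ suc n ℚ./ 1) ∎)
  where
  open ℚᵘP.≃-Reasoning
  cross-multiplied : ∀ x → (ℤ.1ℤ ℤ.* ℤ.1ℤ ℤ.+ x ℤ.* ℤ.1ℤ) ℤ.* ℤ.1ℤ ≡ (ℤ.1ℤ ℤ.+ x) ℤ.* (ℤ.1ℤ ℤ.* ℤ.1ℤ)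
  cross-multiplied = solve-∀

[1+n]/1*[1/[1+n]]≡1 : ∀ n → (+ suc n ℚ./ 1) ℚ.* (+ 1 ℚ./ suc n) ≡ ℚ.1ℚ
[1+n]/1*[1/[1+n]]≡1 n = ℚP.toℚᵘ-injective (begin
  ℚ.toℚᵘ ((+ suc n ℚ./ 1) ℚ.* (+ 1 ℚ./ suc n))
    ≈⟨ ℚP.toℚᵘ-homo-* (+ suc n ℚ./ 1) (+ 1 ℚ./ suc n) ⟩
  ℚ.toℚᵘ (+ suc n ℚ./ 1) ℚᵘ.* ℚ.toℚᵘ (+ 1 ℚ./ suc n)
    ≈⟨ ℚᵘP.*-cong (ℚP.toℚᵘ-fromℚᵘ (+ suc n ℚᵘ./ 1)) (ℚP.toℚᵘ-fromℚᵘ (+ 1 ℚᵘ./ suc n)) ⟩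
  (+ suc n ℚᵘ./ 1) ℚᵘ.* (+ 1 ℚᵘ./ suc n)
    ≈⟨ ℚᵘ.*≡* (cross-multiplied (+ n)) ⟩
  ℚᵘ.1ℚᵘ
    ≈⟨ ℚP.toℚᵘ-fromℚᵘ ℚᵘ.1ℚᵘ ⟨
  ℚ.toℚᵘ ℚ.1ℚ ∎)
  where
  open ℚᵘP.≃-Reasoning
  cross-multiplied : ∀ x → ((ℤ.1ℤ ℤ.+ x) ℤ.* ℤ.1ℤ) ℤ.* ℤ.1ℤ ≡ ℤ.1ℤ ℤ.* (ℤ.1ℤ ℤ.* (ℤ.1ℤ ℤ.+ x))
  cross-multiplied = solve-∀

T-injective : ∀ {a b} → (T a → T b) → (T b → T a) → a ≡ b
T-injective {false} {false} _ _ = ≡.refl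
T-injective {false} {true}  _ b⇒a = ⊥-elim (b⇒a tt)
T-injective {true}  {false} a⇒b _ = ⊥-elim (a⇒b tt)
T-injective {true}  {true}  _ _ = ≡.refl

infix 4 _==_
_==_ : List ℕ → List ℕ → Bool
[]      == []      = true
[]      == (_ ∷ _) = false
(_ ∷ _) == []      = false
(a ∷ x) == (b ∷ y) = (a ≡ᵇ b) ∧ (x == y)

==⇒≡ : ∀ {x y} → T (x == y) → x ≡ y
==⇒≡ {[]}    {[]}    _ = ≡.refl
==⇒≡ {a ∷ x} {b ∷ y} h with Equivalence.to T-∧ h
... | a≡b , x==y = ≡.cong₂ _∷_ (ℕP.≡ᵇ⇒≡ a b a≡b) (==⇒≡ x==y)

≡⇒== : ∀ {x y} → x ≡ y → T (x == y)
≡⇒== {[]}    ≡.refl = tt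
≡⇒== {a ∷ x} ≡.refl = Equivalence.from T-∧ (ℕP.≡⇒≡ᵇ a a ≡.refl , ≡⇒== {x} ≡.refl)

Composition : ℕ → List ℕ → Set
Composition N μ = All (1 ≤_) μ × sum μ ≡ N

composition-zero : ∀ {μ} → Composition 0 μ → μ ≡ []
composition-zero {[]}    _ = ≡.refl
composition-zero {_ ∷ _} (s≤s _ ∷ _ , ())

composition-∷ : ∀ {N i μ} → i ≤ N → Composition (N ∸ i) μ → Composition (suc N) (suc i ∷ μ)
composition-∷ {i = i} i≤N (μ>0 , Σμ) =
  s≤s z≤n ∷ μ>0 , ≡.cong suc (≡.trans (≡.cong (i ℕ.+_) Σμ) (ℕP.m+[n∸m]≡n i≤N))

composition-↭ : ∀ {N μ ν} → μ ↭ ν → Composition N μ → Composition N ν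
composition-↭ μ↭ν (μ>0 , Σμ) = All-resp-↭ μ↭ν μ>0 , ≡.trans (≡.sym (sum-↭ μ↭ν)) Σμ

removeOne-just⇒↭ : ∀ x ys {ys′} → removeOne x ys ≡ just ys′ → ys ↭ x ∷ ys′
removeOne-just⇒↭ x (y ∷ ys) eq with x ≡ᵇ y in x≡ᵇy
removeOne-just⇒↭ x (y ∷ ys) ≡.refl | true rewrite ℕP.≡ᵇ⇒≡ x y (≡.subst T (≡.sym x≡ᵇy) tt) = ↭-refl
... | false with removeOne x ys in eq′
removeOne-just⇒↭ x (y ∷ ys) ≡.refl | false | just ys″ =
  ↭-trans (↭-prep y (removeOne-just⇒↭ x ys eq′)) (↭-swap y x ↭-refl)

removeOne-nothing⇒∉ : ∀ x ys → removeOne x ys ≡ nothing → x ∉ ys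
removeOne-nothing⇒∉ x (y ∷ ys) eq x∈ with x ≡ᵇ y in x≡ᵇy
removeOne-nothing⇒∉ x (y ∷ ys) () x∈ | true
... | false with removeOne x ys in eq′
removeOne-nothing⇒∉ x (y ∷ ys) ≡.refl (here ≡.refl) | false | nothing = ≡.subst T x≡ᵇy (ℕP.≡⇒≡ᵇ x x ≡.refl)
removeOne-nothing⇒∉ x (y ∷ ys) ≡.refl (there x∈) | false | nothing = removeOne-nothing⇒∉ x ys eq′ x∈

isPermᵇ⇒↭ : ∀ xs ys → T (isPermᵇ xs ys) → xs ↭ ys
isPermᵇ⇒↭ []       []  _ = ↭-refl
isPermᵇ⇒↭ (x ∷ xs) ys  h with removeOne x ys in eq
... | just ys′ = ↭-trans (↭-prep x (isPermᵇ⇒↭ xs ys′ h)) (↭-sym (removeOne-just⇒↭ x ys eq))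

↭⇒isPermᵇ : ∀ xs ys → xs ↭ ys → T (isPermᵇ xs ys)
↭⇒isPermᵇ []       ys xs↭ys with ↭-empty-inv (↭-sym xs↭ys)
... | ≡.refl = tt
↭⇒isPermᵇ (x ∷ xs) ys xs↭ys with removeOne x ys in eq
... | nothing  = ⊥-elim (removeOne-nothing⇒∉ x ys eq (∈-resp-↭ xs↭ys (here ≡.refl)))
... | just ys′ = ↭⇒isPermᵇ xs ys′ (drop-∷ (↭-trans xs↭ys (removeOne-just⇒↭ x ys eq)))

nonIncreasing⇒Sorted : ∀ μ → T (nonIncreasing μ) → Sorted μ
nonIncreasing⇒Sorted []          _ = []
nonIncreasing⇒Sorted (a ∷ [])    _ = [-]
nonIncreasing⇒Sorted (a ∷ b ∷ μ) h =
  let b≤a , rest = Equivalence.to T-∧ h in ℕP.≤ᵇ⇒≤ b a b≤a ∷ nonIncreasing⇒Sorted (b ∷ μ) rest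

Sorted⇒nonIncreasing : ∀ {μ} → Sorted μ → T (nonIncreasing μ)
Sorted⇒nonIncreasing []          = tt
Sorted⇒nonIncreasing [-]         = tt
Sorted⇒nonIncreasing (b≤a ∷ rest) = Equivalence.from T-∧ (ℕP.≤⇒≤ᵇ b≤a , Sorted⇒nonIncreasing rest)

nonIncreasing∧isPermᵇ≡==sort : ∀ λ′ μ → (nonIncreasing μ ∧ isPermᵇ λ′ μ) ≡ (μ == sort λ′)
nonIncreasing∧isPermᵇ≡==sort λ′ μ = T-injective to from
  where
  to : T (nonIncreasing μ ∧ isPermᵇ λ′ μ) → T (μ == sort λ′)
  to h with Equivalence.to T-∧ h
  ... | μ↘ , λ′↭μ = ≡⇒== (Pointwise-≡⇒≡ (↗↭↗⇒≋ (DecTotalOrder.totalOrder ≥-decTotalOrder)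
          (nonIncreasing⇒Sorted μ μ↘) (sort-↗ λ′)
          (↭⇒↭ₛ (↭-trans (↭-sym (isPermᵇ⇒↭ λ′ μ λ′↭μ)) (↭-sym (sort-↭ λ′))))))
  from : T (μ == sort λ′) → T (nonIncreasing μ ∧ isPermᵇ λ′ μ)
  from h = ≡.subst (λ ν → T (nonIncreasing ν ∧ isPermᵇ λ′ ν)) (≡.sym (==⇒≡ h))
    (Equivalence.from T-∧ (Sorted⇒nonIncreasing (sort-↗ λ′) , ↭⇒isPermᵇ λ′ (sort λ′) (↭-sym (sort-↭ λ′))))

[n+m]∸[1+n+i]<m : ∀ n {m i} → i < m → (n ℕ.+ m) ∸ (suc n ℕ.+ i) < m
[n+m]∸[1+n+i]<m n {suc m} {i} (s≤s i≤m) = begin-strict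
  (n ℕ.+ suc m) ∸ (suc n ℕ.+ i)  ≡⟨ ≡.cong ((n ℕ.+ suc m) ∸_) (ℕP.+-suc n i) ⟨
  (n ℕ.+ suc m) ∸ (n ℕ.+ suc i)  ≡⟨ ℕP.[m+n]∸[m+o]≡n∸o n (suc m) (suc i) ⟩
  m ∸ i                          ≤⟨ ℕP.m∸n≤m m i ⟩
  m                              <⟨ ℕP.n<1+n m ⟩
  suc m                          ∎
  where open ℕP.≤-Reasoning

fallingℤ≡P′ : ∀ {n L} → L ≤ n → fallingℤ n L ≡ + (n P′ L)
fallingℤ≡P′ {n} {zero}  _   = ≡.refl
fallingℤ≡P′ {n} {suc L} L<n = begin
  fallingℤ n L ℤ.* (+ n ℤ.- + L)  ≡⟨ ≡.cong₂ ℤ._*_ (fallingℤ≡P′ (ℕP.<⇒≤ L<n)) n-L≡n∸L ⟩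
  + (n P′ L) ℤ.* + (n ∸ L)        ≡⟨ ℤP.pos-* (n P′ L) (n ∸ L) ⟨
  + ((n P′ L) ℕ.* (n ∸ L))        ≡⟨ ≡.cong +_ (ℕP.*-comm (n P′ L) (n ∸ L)) ⟩
  + (n P′ suc L)                  ∎
  where
  open ≡.≡-Reasoning
  n-L≡n∸L : + n ℤ.- + L ≡ + (n ∸ L)
  n-L≡n∸L = ≡.trans (ℤP.[+m]-[+n]≡m⊖n n L) (ℤP.⊖-≥ (ℕP.<⇒≤ L<n))

fallingℤ≡0 : ∀ {n L} → n < L → fallingℤ n L ≡ + 0
fallingℤ≡0 {n} {suc L} (s≤s n≤L) with ℕP.m≤n⇒m<n∨m≡n n≤L
... | inj₁ n<L = ≡.trans (≡.cong (ℤ._* (+ n ℤ.- + L)) (fallingℤ≡0 n<L)) (ℤP.*-zeroˡ (+ n ℤ.- + L))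
... | inj₂ ≡.refl = ≡.trans (≡.cong (fallingℤ n n ℤ.*_) (≡.trans (ℤP.[+m]-[+n]≡m⊖n n n) (ℤP.n⊖n≡0 n)))
                            (ℤP.*-zeroʳ (fallingℤ n n))

P′*[n∸k]!≡n! : ∀ {n k} → k ≤ n → (n P′ k) ℕ.* (n ∸ k) ! ≡ n !
P′*[n∸k]!≡n! {n} {k} k≤n =
  ≡.trans (≡.cong (ℕ._* (n ∸ k) !) (nP′k≡n!/[n∸k]! k≤n)) (m/n*n≡m (m≤n⇒m!∣n! (ℕP.m∸n≤m n k)))
  where instance _ = (n ∸ k) ℕP.!≢0

invProdFrom-∷ʳ : ∀ μ j s a → invProdFrom j s (μ ++ [ a ]) ≡
                 invProdFrom j s μ ℚ.* (+ 1 ℚ./ suc (j ℕ.+ length μ ℕ.+ (s ℕ.+ sum μ ℕ.+ a)))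
invProdFrom-∷ʳ [] j s a = begin
  x ℚ.* ℚ.1ℚ                     ≡⟨ ℚP.*-comm x ℚ.1ℚ ⟩
  ℚ.1ℚ ℚ.* x                     ≡⟨ ≡.cong (λ k → ℚ.1ℚ ℚ.* (+ 1 ℚ./ suc k)) index ⟩
  ℚ.1ℚ ℚ.* (+ 1 ℚ./ suc (j ℕ.+ 0 ℕ.+ (s ℕ.+ 0 ℕ.+ a))) ∎
  where
  open ≡.≡-Reasoning
  x = + 1 ℚ./ suc (j ℕ.+ (s ℕ.+ a))
  index : j ℕ.+ (s ℕ.+ a) ≡ j ℕ.+ 0 ℕ.+ (s ℕ.+ 0 ℕ.+ a)
  index = ≡.cong₂ (λ u v → u ℕ.+ (v ℕ.+ a)) (≡.sym (ℕP.+-identityʳ j)) (≡.sym (ℕP.+-identityʳ s))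
invProdFrom-∷ʳ (b ∷ μ) j s a = begin
  x ℚ.* invProdFrom (suc j) (s ℕ.+ b) (μ ++ [ a ])            ≡⟨ ≡.cong (x ℚ.*_) (invProdFrom-∷ʳ μ (suc j) (s ℕ.+ b) a) ⟩
  x ℚ.* (invProdFrom (suc j) (s ℕ.+ b) μ ℚ.* (+ 1 ℚ./ suc k)) ≡⟨ ℚP.*-assoc x _ _ ⟨
  invProdFrom j s (b ∷ μ) ℚ.* (+ 1 ℚ./ suc k)                 ≡⟨ ≡.cong (λ k → invProdFrom j s (b ∷ μ) ℚ.* (+ 1 ℚ./ suc k)) index ⟩
  invProdFrom j s (b ∷ μ) ℚ.* (+ 1 ℚ./ suc (j ℕ.+ length (b ∷ μ) ℕ.+ (s ℕ.+ sum (b ∷ μ) ℕ.+ a))) ∎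
  where
  open ≡.≡-Reasoning
  x = + 1 ℚ./ suc (j ℕ.+ (s ℕ.+ b))
  k = suc j ℕ.+ length μ ℕ.+ (s ℕ.+ b ℕ.+ sum μ ℕ.+ a)
  index : k ≡ j ℕ.+ suc (length μ) ℕ.+ (s ℕ.+ (b ℕ.+ sum μ) ℕ.+ a)
  index = ≡.cong₂ (λ u v → u ℕ.+ (v ℕ.+ a)) (≡.sym (ℕP.+-suc j (length μ))) (ℕP.+-assoc s b (sum μ))

module FiniteSums {c ℓ : Level} (S : CommutativeSemiring c ℓ) where
  open CommutativeSemiring S
  open import Relation.Binary.Reasoning.Setoid setoid
  open import Algebra.Properties.CommutativeSemigroup +-commutativeSemigroup using (interchange)

  when : Bool → Carrier → Carrier
  when b x = if b then x else 0#

  when-cong : ∀ b {x y} → (T b → x ≈ y) → when b x ≈ when b y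
  when-cong true  x≈y = x≈y tt
  when-cong false _   = refl

  when-T : ∀ {b} x → T b → when b x ≈ x
  when-T {true} x _ = refl

  when-¬T : ∀ {b} x → (T b → ⊥) → when b x ≈ 0#
  when-¬T {true}  x ¬b = ⊥-elim (¬b tt)
  when-¬T {false} x _  = refl

  when-∧ˡ : ∀ {a} → T a → ∀ b x → when (a ∧ b) x ≡ when b x
  when-∧ˡ {true} _ b x = ≡.refl

  when-∧ : ∀ a b x → when a (when b x) ≡ when (a ∧ b) x
  when-∧ true  b x = ≡.refl
  when-∧ false b x = ≡.refl

  ∑ : ∀ {a} {A : Set a} → List A → (A → Carrier) → Carrier
  ∑ L F = foldr _+_ 0# (map F L)

  module _ {a} {A : Set a} where

    ∑-cong : ∀ (L : List A) {F G} → (∀ x → F x ≈ G x) → ∑ L F ≈ ∑ L G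
    ∑-cong []      _   = refl
    ∑-cong (x ∷ L) F≈G = +-cong (F≈G x) (∑-cong L F≈G)

    ∑-zero : ∀ (L : List A) {F} → (∀ x → F x ≈ 0#) → ∑ L F ≈ 0#
    ∑-zero []      _   = refl
    ∑-zero (x ∷ L) F≈0 = trans (+-cong (F≈0 x) (∑-zero L F≈0)) (+-identityʳ 0#)

    ∑-+ : ∀ (L : List A) {F G} → ∑ L (λ x → F x + G x) ≈ ∑ L F + ∑ L G
    ∑-+ []              = sym (+-identityʳ 0#)
    ∑-+ (x ∷ L) {F} {G} = trans (+-congˡ (∑-+ L)) (interchange (F x) (G x) _ _)

    *-distribˡ-∑ : ∀ c (L : List A) {F} → c * ∑ L F ≈ ∑ L (λ x → c * F x)
    *-distribˡ-∑ c []      = zeroʳ c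
    *-distribˡ-∑ c (x ∷ L) = trans (distribˡ c _ _) (+-congˡ (*-distribˡ-∑ c L))

    ∑-++ : ∀ (xs ys : List A) {F} → ∑ (xs ++ ys) F ≈ ∑ xs F + ∑ ys F
    ∑-++ []       ys = sym (+-identityˡ _)
    ∑-++ (x ∷ xs) ys = trans (+-congˡ (∑-++ xs ys)) (sym (+-assoc _ _ _))

    ∑-filter : ∀ (p : A → Bool) (L : List A) {F} → ∑ (filterᵇ p L) F ≈ ∑ L (λ x → when (p x) (F x))
    ∑-filter p []      = refl
    ∑-filter p (x ∷ L) with p x
    ... | true  = +-congˡ (∑-filter p L)
    ... | false = trans (∑-filter p L) (sym (+-identityˡ _))

    ∑-filter-cong : ∀ (p : A → Bool) (L : List A) {F G} → (∀ x → T (p x) → F x ≈ G x) →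
                    ∑ (filterᵇ p L) F ≈ ∑ (filterᵇ p L) G
    ∑-filter-cong p []      _   = refl
    ∑-filter-cong p (x ∷ L) F≈G with p x in px
    ... | true  = +-cong (F≈G x (≡.subst T (≡.sym px) tt)) (∑-filter-cong p L F≈G)
    ... | false = ∑-filter-cong p L F≈G

    ∑-when : ∀ b (L : List A) {F} → ∑ L (λ x → when b (F x)) ≈ when b (∑ L F)
    ∑-when true  L = refl
    ∑-when false L = ∑-zero L (λ _ → refl)

  module _ {a b} {A : Set a} {B : Set b} where

    ∑-map : ∀ (h : A → B) (L : List A) {F : B → Carrier} → ∑ (map h L) F ≡ ∑ L (F ∘ h)
    ∑-map h []      = ≡.refl
    ∑-map h (x ∷ L) = ≡.cong (_+_ _) (∑-map h L)

    ∑-concatMap : ∀ (G : A → List B) (L : List A) {F} → ∑ (concatMap G L) F ≈ ∑ L (λ x → ∑ (G x) F)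
    ∑-concatMap G []      = refl
    ∑-concatMap G (x ∷ L) = trans (∑-++ (G x) (concatMap G L)) (+-congˡ (∑-concatMap G L))

    ∑-comm : ∀ (As : List A) (Bs : List B) (F : A → B → Carrier) →
             ∑ As (λ x → ∑ Bs (F x)) ≈ ∑ Bs (λ y → ∑ As (λ x → F x y))
    ∑-comm []       Bs F = sym (∑-zero Bs (λ _ → refl))
    ∑-comm (x ∷ As) Bs F = trans (+-congˡ (∑-comm As Bs F)) (sym (∑-+ Bs))

  ∑< : ℕ → (ℕ → Carrier) → Carrier
  ∑< zero    h = 0#
  ∑< (suc N) h = h 0 + ∑< N (h ∘ suc)

  ∑-applyUpTo : ∀ (f : ℕ → ℕ) N {F} → ∑ (applyUpTo f N) F ≡ ∑< N (F ∘ f)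
  ∑-applyUpTo f zero    = ≡.refl
  ∑-applyUpTo f (suc N) = ≡.cong (_+_ _) (∑-applyUpTo (f ∘ suc) N)

  ∑<-cong : ∀ N {h h′} → (∀ i → i < N → h i ≈ h′ i) → ∑< N h ≈ ∑< N h′
  ∑<-cong zero    _    = refl
  ∑<-cong (suc N) h≈h′ = +-cong (h≈h′ 0 (s≤s z≤n)) (∑<-cong N (λ i i<N → h≈h′ (suc i) (s≤s i<N)))

  ∑<-zero : ∀ N {h} → (∀ i → i < N → h i ≈ 0#) → ∑< N h ≈ 0#
  ∑<-zero N h≈0 = trans (∑<-cong N h≈0) (zero-sum N)
    where
    zero-sum : ∀ N → ∑< N (λ _ → 0#) ≈ 0#
    zero-sum zero    = refl
    zero-sum (suc N) = trans (+-identityˡ _) (zero-sum N)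

  ∑<-single : ∀ N {h} j → j < N → (∀ i → i < N → i ≢ j → h i ≈ 0#) → ∑< N h ≈ h j
  ∑<-single (suc N) zero    _         h≈0 =
    trans (+-congˡ (∑<-zero N (λ i i<N → h≈0 (suc i) (s≤s i<N) (λ ())))) (+-identityʳ _)
  ∑<-single (suc N) (suc j) (s≤s j<N) h≈0 =
    trans (+-cong (h≈0 0 (s≤s z≤n) (λ ()))
                  (∑<-single N j j<N (λ i i<N i≢j → h≈0 (suc i) (s≤s i<N) (i≢j ∘ ℕP.suc-injective))))
          (+-identityˡ _)

  ∑<-+ : ∀ M N {h} → ∑< (M ℕ.+ N) h ≈ ∑< M h + ∑< N (λ i → h (M ℕ.+ i))
  ∑<-+ zero    N = sym (+-identityˡ _)
  ∑<-+ (suc M) N = trans (+-congˡ (∑<-+ M N)) (sym (+-assoc _ _ _))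

module CompositionSums {c ℓ : Level} (S : CommutativeSemiring c ℓ) where
  open CommutativeSemiring S
  open FiniteSums S
  open import Relation.Binary.Reasoning.Setoid setoid

  ∑-compsF-suc : ∀ f N F →
                 ∑ (compsF (suc f) (suc N)) F ≈ ∑< (suc N) (λ i → ∑ (compsF f (N ∸ i)) (λ μ → F (suc i ∷ μ)))
  ∑-compsF-suc f N F = begin
    ∑ (compsF (suc f) (suc N)) F                          ≈⟨ ∑-concatMap firstPart (map suc (upTo (suc N))) ⟩
    ∑ (map suc (upTo (suc N))) (λ k → ∑ (firstPart k) F)   ≡⟨ ∑-map suc (upTo (suc N)) ⟩
    ∑ (upTo (suc N)) (λ i → ∑ (firstPart (suc i)) F)       ≡⟨ ∑-applyUpTo id (suc N) ⟩
    ∑< (suc N) (λ i → ∑ (firstPart (suc i)) F)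
      ≈⟨ ∑<-cong (suc N) (λ i _ → reflexive (∑-map (suc i ∷_) (compsF f (N ∸ i)) {F})) ⟩
    ∑< (suc N) (λ i → ∑ (compsF f (N ∸ i)) (λ μ → F (suc i ∷ μ))) ∎
    where
    firstPart : ℕ → List (List ℕ)
    firstPart k = map (k ∷_) (compsF f (suc N ∸ k))

  ∑-compsF-cong : ∀ f N {F G} → (∀ μ → Composition N μ → F μ ≈ G μ) → ∑ (compsF f N) F ≈ ∑ (compsF f N) G
  ∑-compsF-cong f       zero    F≈G = +-congʳ (F≈G [] ([] , ≡.refl))
  ∑-compsF-cong zero    (suc N) F≈G = refl
  ∑-compsF-cong (suc f) (suc N) {F} {G} F≈G = begin
    ∑ (compsF (suc f) (suc N)) F                                  ≈⟨ ∑-compsF-suc f N F ⟩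
    ∑< (suc N) (λ i → ∑ (compsF f (N ∸ i)) (λ μ → F (suc i ∷ μ)))  ≈⟨ ∑<-cong (suc N) (λ i i≤N →
      ∑-compsF-cong f (N ∸ i) (λ μ μ⊨ → F≈G (suc i ∷ μ) (composition-∷ (ℕP.≤-pred i≤N) μ⊨))) ⟩
    ∑< (suc N) (λ i → ∑ (compsF f (N ∸ i)) (λ μ → G (suc i ∷ μ)))  ≈⟨ ∑-compsF-suc f N G ⟨
    ∑ (compsF (suc f) (suc N)) G                                  ∎

  ∑-compsF-single : ∀ f N {ν} t → Composition N ν → N ≤ f → ∑ (compsF f N) (λ μ → when (μ == ν) t) ≈ t
  ∑-compsF-single f zero {ν} t ν⊨ _ rewrite composition-zero ν⊨ = +-identityʳ t
  ∑-compsF-single (suc f) (suc N) {suc a ∷ ν} t (_ ∷ ν>0 , Σν) (s≤s N≤f) = begin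
    ∑ (compsF (suc f) (suc N)) (λ μ → when (μ == suc a ∷ ν) t)
      ≈⟨ ∑-compsF-suc f N _ ⟩
    ∑< (suc N) (λ i → ∑ (compsF f (N ∸ i)) (λ μ → when ((i ≡ᵇ a) ∧ (μ == ν)) t))
      ≈⟨ ∑<-single (suc N) a a<1+N (λ i _ i≢a → ∑-zero (compsF f (N ∸ i)) (λ μ →
           when-¬T t (λ h → i≢a (ℕP.≡ᵇ⇒≡ i a (proj₁ (Equivalence.to T-∧ h)))))) ⟩
    ∑ (compsF f (N ∸ a)) (λ μ → when ((a ≡ᵇ a) ∧ (μ == ν)) t)
      ≈⟨ ∑-cong (compsF f (N ∸ a)) (λ μ → reflexive (when-∧ˡ (ℕP.≡⇒≡ᵇ a a ≡.refl) (μ == ν) t)) ⟩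
    ∑ (compsF f (N ∸ a)) (λ μ → when (μ == ν) t)
      ≈⟨ ∑-compsF-single f (N ∸ a) t (ν>0 , Σν′) (ℕP.≤-trans (ℕP.m∸n≤m N a) N≤f) ⟩
    t ∎
    where
    a+Σν≡N : a ℕ.+ sum ν ≡ N
    a+Σν≡N = ℕP.suc-injective Σν
    a<1+N : a < suc N
    a<1+N = s≤s (≡.subst (a ≤_) a+Σν≡N (ℕP.m≤m+n a (sum ν)))
    Σν′ : sum ν ≡ N ∸ a
    Σν′ = ≡.trans (≡.sym (ℕP.m+n∸m≡n a (sum ν))) (≡.cong (_∸ a) a+Σν≡N)

  ∑-compsF-reindex : ∀ f f′ N (σ : List ℕ → List ℕ) F → N ≤ f → N ≤ f′ → (∀ x → σ (σ x) ≡ x) →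
                     (∀ x → Composition N x → Composition N (σ x)) →
                     ∑ (compsF f N) (F ∘ σ) ≈ ∑ (compsF f′ N) F
  ∑-compsF-reindex f f′ N σ F N≤f N≤f′ σσ≡id σ⊨ = begin
    ∑ (compsF f N) (F ∘ σ)
      ≈⟨ ∑-compsF-cong f N (λ x x⊨ → sym (trans
           (∑-cong (compsF f′ N) (λ μ → when-cong (μ == σ x) (λ h → reflexive (≡.cong F (==⇒≡ h)))))
           (∑-compsF-single f′ N (F (σ x)) (σ⊨ x x⊨) N≤f′))) ⟩
    ∑ (compsF f N) (λ x → ∑ (compsF f′ N) (λ μ → when (μ == σ x) (F μ)))
      ≈⟨ ∑-comm (compsF f N) (compsF f′ N) _ ⟩
    ∑ (compsF f′ N) (λ μ → ∑ (compsF f N) (λ x → when (μ == σ x) (F μ)))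
      ≈⟨ ∑-compsF-cong f′ N (λ μ μ⊨ → trans
           (∑-cong (compsF f N) (λ x → reflexive (≡.cong (λ b → when b (F μ)) (σ-swap μ x))))
           (∑-compsF-single f N (F μ) (σ⊨ μ μ⊨) N≤f)) ⟩
    ∑ (compsF f′ N) F ∎
    where
    σ-swap : ∀ μ x → (μ == σ x) ≡ (x == σ μ)
    σ-swap μ x = T-injective
      (λ h → ≡⇒== (≡.trans (≡.sym (σσ≡id x)) (≡.cong σ (≡.sym (==⇒≡ h)))))
      (λ h → ≡⇒== (≡.trans (≡.sym (σσ≡id μ)) (≡.cong σ (≡.sym (==⇒≡ h)))))

  ∑-compositions-last : ∀ N F → ∑ (compositions (suc N)) F ≈
                        ∑< (suc N) (λ i → ∑ (compositions (N ∸ i)) (λ μ → F (μ ++ [ suc i ])))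
  ∑-compositions-last N F = begin
    ∑ (compositions (suc N)) F
      ≈⟨ ∑-compsF-reindex (suc N) (suc N) (suc N) reverse F ℕP.≤-refl ℕP.≤-refl reverse-involutive reverse⊨ ⟨
    ∑ (compositions (suc N)) (F ∘ reverse)
      ≈⟨ ∑-compsF-suc N N (F ∘ reverse) ⟩
    ∑< (suc N) (λ i → ∑ (compsF N (N ∸ i)) (λ μ → F (reverse (suc i ∷ μ))))
      ≈⟨ ∑<-cong (suc N) (λ i _ → trans
           (∑-cong (compsF N (N ∸ i)) (λ μ → reflexive (≡.cong F (unfold-reverse (suc i) μ))))
           (∑-compsF-reindex N (N ∸ i) (N ∸ i) reverse (λ μ → F (μ ++ [ suc i ]))
              (ℕP.m∸n≤m N i) ℕP.≤-refl reverse-involutive reverse⊨)) ⟩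
    ∑< (suc N) (λ i → ∑ (compositions (N ∸ i)) (λ μ → F (μ ++ [ suc i ]))) ∎
    where
    reverse⊨ : ∀ {M} x → Composition M x → Composition M (reverse x)
    reverse⊨ x = composition-↭ (↭-sym (↭-reverse x))

  -- A composition λ′ of N lies in the orbit of exactly one partition of N, namely of sort λ′.
  ∑-partitions-Orb : ∀ N F → ∑ (partitions N) (λ μ → ∑ (Orb μ) F) ≈ ∑ (compositions N) F
  ∑-partitions-Orb N F = begin
    ∑ (partitions N) (λ μ → ∑ (Orb μ) F)
      ≈⟨ ∑-filter nonIncreasing (compositions N) ⟩
    ∑ C (λ μ → when (nonIncreasing μ) (∑ (Orb μ) F))
      ≈⟨ ∑-compsF-cong N N (λ μ (_ , Σμ) → when-cong (nonIncreasing μ) (λ _ → begin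
           ∑ (Orb μ) F
             ≡⟨ ≡.cong (λ M → ∑ (filterᵇ (λ λ′ → isPermᵇ λ′ μ) (compositions M)) F) Σμ ⟩
           ∑ (filterᵇ (λ λ′ → isPermᵇ λ′ μ) C) F
             ≈⟨ ∑-filter (λ λ′ → isPermᵇ λ′ μ) C ⟩
           ∑ C (λ λ′ → when (isPermᵇ λ′ μ) (F λ′)) ∎)) ⟩
    ∑ C (λ μ → when (nonIncreasing μ) (∑ C (λ λ′ → when (isPermᵇ λ′ μ) (F λ′))))
      ≈⟨ ∑-cong C (λ μ → trans (sym (∑-when (nonIncreasing μ) C))
           (∑-cong C (λ λ′ → reflexive (when-∧ (nonIncreasing μ) (isPermᵇ λ′ μ) (F λ′))))) ⟩
    ∑ C (λ μ → ∑ C (λ λ′ → when (nonIncreasing μ ∧ isPermᵇ λ′ μ) (F λ′)))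
      ≈⟨ ∑-comm C C _ ⟩
    ∑ C (λ λ′ → ∑ C (λ μ → when (nonIncreasing μ ∧ isPermᵇ λ′ μ) (F λ′)))
      ≈⟨ ∑-compsF-cong N N (λ λ′ λ′⊨ → trans
           (∑-cong C (λ μ → reflexive (≡.cong (λ b → when b (F λ′)) (nonIncreasing∧isPermᵇ≡==sort λ′ μ))))
           (∑-compsF-single N N (F λ′) (composition-↭ (↭-sym (sort-↭ λ′)) λ′⊨) ℕP.≤-refl)) ⟩
    ∑ C F ∎
    where
    C = compositions N

module ℚAlgebra {c ℓ : Level} (R : CommutativeRing c ℓ) (ι : ℚ → CommutativeRing.Carrier R)
  (hom : RingMorphisms.IsRingHomomorphism +-*-rawRing (CommutativeRing.rawRing R) ι) where

  open CommutativeRing R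
  open FiniteSums commutativeSemiring
  open import Relation.Binary.Reasoning.Setoid setoid
  open import Algebra.Properties.CommutativeSemigroup *-commutativeSemigroup using (interchange)
  module ι = RingMorphisms.IsRingHomomorphism hom

  ιₙ : ℕ → Carrier
  ιₙ k = ι (+ k ℚ./ 1)

  ιₙ-suc : ∀ k → ιₙ (suc k) ≈ 1# + ιₙ k
  ιₙ-suc k = begin
    ι (+ suc k ℚ./ 1)            ≡⟨ ≡.cong ι (1+[n/1]≡[1+n]/1 k) ⟨
    ι (ℚ.1ℚ ℚ.+ (+ k ℚ./ 1))     ≈⟨ ι.+-homo ℚ.1ℚ (+ k ℚ./ 1) ⟩
    ι ℚ.1ℚ + ιₙ k                ≈⟨ +-congʳ ι.1#-homo ⟩
    1# + ιₙ k                    ∎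

  ιₙ-+ : ∀ a b → ιₙ (a ℕ.+ b) ≈ ιₙ a + ιₙ b
  ιₙ-+ zero    b = trans (sym (+-identityˡ _)) (+-congʳ (sym ι.0#-homo))
  ιₙ-+ (suc a) b = begin
    ιₙ (suc (a ℕ.+ b))    ≈⟨ ιₙ-suc (a ℕ.+ b) ⟩
    1# + ιₙ (a ℕ.+ b)     ≈⟨ +-congˡ (ιₙ-+ a b) ⟩
    1# + (ιₙ a + ιₙ b)    ≈⟨ +-assoc _ _ _ ⟨
    (1# + ιₙ a) + ιₙ b    ≈⟨ +-congʳ (ιₙ-suc a) ⟨
    ιₙ (suc a) + ιₙ b     ∎

  ιₙ-* : ∀ a b → ιₙ (a ℕ.* b) ≈ ιₙ a * ιₙ b
  ιₙ-* zero    b = trans ι.0#-homo (trans (sym (zeroˡ (ιₙ b))) (*-congʳ (sym ι.0#-homo)))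
  ιₙ-* (suc a) b = begin
    ιₙ (b ℕ.+ a ℕ.* b)        ≈⟨ ιₙ-+ b (a ℕ.* b) ⟩
    ιₙ b + ιₙ (a ℕ.* b)       ≈⟨ +-cong (sym (*-identityˡ (ιₙ b))) (ιₙ-* a b) ⟩
    1# * ιₙ b + ιₙ a * ιₙ b   ≈⟨ distribʳ (ιₙ b) 1# (ιₙ a) ⟨
    (1# + ιₙ a) * ιₙ b        ≈⟨ *-congʳ (ιₙ-suc a) ⟨
    ιₙ (suc a) * ιₙ b         ∎

  invSuc : ℕ → Carrier
  invSuc k = ι (+ 1 ℚ./ suc k)

  ιₙ-suc*invSuc : ∀ k → ιₙ (suc k) * invSuc k ≈ 1#
  ιₙ-suc*invSuc k = begin
    ιₙ (suc k) * invSuc k                     ≈⟨ ι.*-homo (+ suc k ℚ./ 1) (+ 1 ℚ./ suc k) ⟨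
    ι ((+ suc k ℚ./ 1) ℚ.* (+ 1 ℚ./ suc k))   ≡⟨ ≡.cong ι ([1+n]/1*[1/[1+n]]≡1 k) ⟩
    ι ℚ.1ℚ                                    ≈⟨ ι.1#-homo ⟩
    1#                                        ∎

  invFact : ℕ → Carrier
  invFact zero    = 1#
  invFact (suc k) = invSuc k * invFact k

  ιₙ-!*invFact : ∀ k → ιₙ (k !) * invFact k ≈ 1#
  ιₙ-!*invFact zero    = trans (*-identityʳ _) ι.1#-homo
  ιₙ-!*invFact (suc k) = begin
    ιₙ (suc k ℕ.* k !) * (invSuc k * invFact k)         ≈⟨ *-congʳ (ιₙ-* (suc k) (k !)) ⟩
    (ιₙ (suc k) * ιₙ (k !)) * (invSuc k * invFact k)    ≈⟨ interchange _ _ _ _ ⟩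
    (ιₙ (suc k) * invSuc k) * (ιₙ (k !) * invFact k)    ≈⟨ *-cong (ιₙ-suc*invSuc k) (ιₙ-!*invFact k) ⟩
    1# * 1#                                             ≈⟨ *-identityˡ 1# ⟩
    1#                                                  ∎

  ιₙ-suc*invFact-suc : ∀ k → ιₙ (suc k) * invFact (suc k) ≈ invFact k
  ιₙ-suc*invFact-suc k = trans (sym (*-assoc _ _ _)) (trans (*-congʳ (ιₙ-suc*invSuc k)) (*-identityˡ _))

  -- 1/(m − r)!, read as 0 when r > m
  invFact∸ : ℕ → ℕ → Carrier
  invFact∸ m r = when (r ≤ᵇ m) (invFact (m ∸ r))

  invFact∸-≤ : ∀ {m r} → r ≤ m → invFact∸ m r ≈ invFact (m ∸ r)
  invFact∸-≤ r≤m = when-T _ (ℕP.≤⇒≤ᵇ r≤m)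

  invFact∸-> : ∀ {m r} → m < r → invFact∸ m r ≈ 0#
  invFact∸-> {m} {r} m<r = when-¬T _ (λ h → ℕP.<⇒≱ m<r (ℕP.≤ᵇ⇒≤ r m h))

  invFact∸-suc : ∀ m r → invFact∸ (suc m) (suc r) ≈ invFact∸ m r
  invFact∸-suc m r with ℕP.≤-<-connex r m
  ... | inj₁ r≤m = trans (invFact∸-≤ (s≤s r≤m)) (sym (invFact∸-≤ r≤m))
  ... | inj₂ m<r = trans (invFact∸-> (s≤s m<r)) (sym (invFact∸-> m<r))

  -- (m + 1 − r) + (S + r) = S + m + 1
  ιₙ*invFact∸-suc : ∀ S m r →
                    ιₙ (suc (S ℕ.+ m)) * invFact∸ (suc m) r ≈ invFact∸ m r + ιₙ (S ℕ.+ r) * invFact∸ (suc m) r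
  ιₙ*invFact∸-suc S m r with ℕP.<-cmp r (suc m)
  ... | tri< (s≤s r≤m) _ _ = begin
    ιₙ (suc (S ℕ.+ m)) * invFact∸ (suc m) r             ≈⟨ *-congˡ invFact∸[1+m,r] ⟩
    ιₙ (suc (S ℕ.+ m)) * invFact (suc d)                ≡⟨ ≡.cong (λ k → ιₙ k * invFact (suc d)) total ⟩
    ιₙ (suc d ℕ.+ (S ℕ.+ r)) * invFact (suc d)          ≈⟨ *-congʳ (ιₙ-+ (suc d) (S ℕ.+ r)) ⟩
    (ιₙ (suc d) + ιₙ (S ℕ.+ r)) * invFact (suc d)       ≈⟨ distribʳ _ _ _ ⟩
    ιₙ (suc d) * invFact (suc d) + ιₙ (S ℕ.+ r) * invFact (suc d)
      ≈⟨ +-cong (trans (ιₙ-suc*invFact-suc d) (sym (invFact∸-≤ r≤m))) (*-congˡ (sym invFact∸[1+m,r])) ⟩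
    invFact∸ m r + ιₙ (S ℕ.+ r) * invFact∸ (suc m) r    ∎
    where
    d = m ∸ r
    invFact∸[1+m,r] : invFact∸ (suc m) r ≈ invFact (suc d)
    invFact∸[1+m,r] = trans (invFact∸-≤ (ℕP.m≤n⇒m≤1+n r≤m)) (reflexive (≡.cong invFact (ℕP.+-∸-assoc 1 r≤m)))
    total : suc (S ℕ.+ m) ≡ suc d ℕ.+ (S ℕ.+ r)
    total = ≡.cong suc (≡.trans (≡.cong (S ℕ.+_) (≡.sym (ℕP.m∸n+n≡m r≤m))) (ℕ+.x∙yz≈y∙xz S d r))
  ... | tri≈ _ ≡.refl _ = begin
    ιₙ (suc (S ℕ.+ m)) * invFact∸ (suc m) (suc m)
      ≡⟨ ≡.cong (λ k → ιₙ k * invFact∸ (suc m) (suc m)) (ℕP.+-suc S m) ⟨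
    ιₙ (S ℕ.+ suc m) * invFact∸ (suc m) (suc m)         ≈⟨ +-identityˡ _ ⟨
    0# + ιₙ (S ℕ.+ suc m) * invFact∸ (suc m) (suc m)    ≈⟨ +-congʳ (invFact∸-> (ℕP.n<1+n m)) ⟨
    invFact∸ m (suc m) + ιₙ (S ℕ.+ suc m) * invFact∸ (suc m) (suc m) ∎
  ... | tri> _ _ 1+m<r = begin
    ιₙ (suc (S ℕ.+ m)) * invFact∸ (suc m) r              ≈⟨ *-congˡ (invFact∸-> 1+m<r) ⟩
    ιₙ (suc (S ℕ.+ m)) * 0#                              ≈⟨ zeroʳ _ ⟩
    0#                                                   ≈⟨ +-identityˡ 0# ⟨
    0# + 0#                                              ≈⟨ +-cong (invFact∸-> (ℕP.<-trans (ℕP.n<1+n m) 1+m<r)) (zeroʳ _) ⟨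
    invFact∸ m r + ιₙ (S ℕ.+ r) * 0#                     ≈⟨ +-congˡ (*-congˡ (invFact∸-> 1+m<r)) ⟨
    invFact∸ m r + ιₙ (S ℕ.+ r) * invFact∸ (suc m) r     ∎

  ιₙ-!*invFact∸ : ∀ N m r → ιₙ ((N ℕ.+ m) !) * invFact∸ m r ≈ ι (ℤtoℚ (fallingℤ (N ℕ.+ m) (N ℕ.+ r)))
  ιₙ-!*invFact∸ N m r with ℕP.≤-<-connex r m
  ... | inj₁ r≤m = begin
    ιₙ (n !) * invFact∸ m r                          ≈⟨ *-congˡ (invFact∸-≤ r≤m) ⟩
    ιₙ (n !) * invFact (m ∸ r)                       ≡⟨ ≡.cong (λ k → ιₙ k * invFact (m ∸ r)) n!≡ ⟨
    ιₙ ((n P′ L) ℕ.* (m ∸ r) !) * invFact (m ∸ r)    ≈⟨ *-congʳ (ιₙ-* (n P′ L) ((m ∸ r) !)) ⟩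
    (ιₙ (n P′ L) * ιₙ ((m ∸ r) !)) * invFact (m ∸ r) ≈⟨ *-assoc _ _ _ ⟩
    ιₙ (n P′ L) * (ιₙ ((m ∸ r) !) * invFact (m ∸ r)) ≈⟨ *-congˡ (ιₙ-!*invFact (m ∸ r)) ⟩
    ιₙ (n P′ L) * 1#                                 ≈⟨ *-identityʳ _ ⟩
    ιₙ (n P′ L)                                      ≡⟨ ≡.cong (ι ∘ ℤtoℚ) (fallingℤ≡P′ L≤n) ⟨
    ι (ℤtoℚ (fallingℤ n L))                          ∎
    where
    n = N ℕ.+ m
    L = N ℕ.+ r
    L≤n : L ≤ n
    L≤n = ℕP.+-monoʳ-≤ N r≤m
    n!≡ : (n P′ L) ℕ.* (m ∸ r) ! ≡ n !
    n!≡ = ≡.trans (≡.cong (λ k → (n P′ L) ℕ.* k !) (≡.sym (ℕP.[m+n]∸[m+o]≡n∸o N m r))) (P′*[n∸k]!≡n! L≤n)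
  ... | inj₂ m<r = begin
    ιₙ ((N ℕ.+ m) !) * invFact∸ m r                  ≈⟨ *-congˡ (invFact∸-> m<r) ⟩
    ιₙ ((N ℕ.+ m) !) * 0#                            ≈⟨ zeroʳ _ ⟩
    0#                                               ≈⟨ ι.0#-homo ⟨
    ι (ℤtoℚ (+ 0))                                   ≡⟨ ≡.cong (ι ∘ ℤtoℚ) (fallingℤ≡0 (ℕP.+-monoʳ-< N m<r)) ⟨
    ι (ℤtoℚ (fallingℤ (N ℕ.+ m) (N ℕ.+ r)))          ∎

  ι-sumℚ : ∀ L → ι (sumℚ L) ≈ ∑ L ι
  ι-sumℚ []      = ι.0#-homo
  ι-sumℚ (x ∷ L) = trans (ι.+-homo x (sumℚ L)) (+-congˡ (ι-sumℚ L))

  ι-invProd-∷ʳ : ∀ μ a → ι (invProd (μ ++ [ a ])) ≈ ι (invProd μ) * invSuc (length μ ℕ.+ (sum μ ℕ.+ a))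
  ι-invProd-∷ʳ μ a = trans (reflexive (≡.cong ι (invProdFrom-∷ʳ μ 0 0 a))) (ι.*-homo _ _)

module CoefficientFormula {c ℓ : Level} (R : CommutativeRing c ℓ) (ι : ℚ → CommutativeRing.Carrier R)
  (hom : RingMorphisms.IsRingHomomorphism +-*-rawRing (CommutativeRing.rawRing R) ι)
  (g : ℕ → CommutativeRing.Carrier R) where

  open CommutativeRing R
  open FiniteSums commutativeSemiring
  open CompositionSums commutativeSemiring
  open ℚAlgebra R ι hom
  open import Relation.Binary.Reasoning.Setoid setoid
  open import Algebra.Properties.CommutativeSemigroup *-commutativeSemigroup using (x∙yz≈y∙xz)
  open import Data.List.Relation.Binary.Permutation.Setoid.Properties setoid using (foldr-commMonoid)

  𝒢-∷ʳ : ∀ μ a → 𝒢 R ι g (μ ++ [ a ]) ≈ 𝒢 R ι g μ * g (a ℕ.+ 1)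
  𝒢-∷ʳ []      a = trans (*-identityʳ _) (sym (*-identityˡ _))
  𝒢-∷ʳ (b ∷ μ) a = trans (*-congˡ (𝒢-∷ʳ μ a)) (sym (*-assoc _ _ _))

  𝒢-↭ : ∀ {λ′ μ} → λ′ ↭ μ → 𝒢 R ι g λ′ ≈ 𝒢 R ι g μ
  𝒢-↭ λ′↭μ = foldr-commMonoid *-isCommutativeMonoid (↭⇒↭ₛ′ isEquivalence (map⁺ (λ a → g (a ℕ.+ 1)) λ′↭μ))

  term : ℕ → List ℕ → Carrier
  term m λ′ = 𝒢 R ι g λ′ * (invFact∸ m (length λ′) * ι (invProd λ′))

  compositionSum : ℕ → ℕ → Carrier
  compositionSum m N = ∑ (compositions N) (term m)

  term-suc : ∀ S m λ′ → ιₙ (suc (S ℕ.+ m)) * term (suc m) λ′ ≈ term m λ′ + ιₙ (S ℕ.+ length λ′) * term (suc m) λ′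
  term-suc S m λ′ = begin
    ιₙ (suc (S ℕ.+ m)) * (G * (F₁ * I))       ≈⟨ x∙yz≈y∙xz _ _ _ ⟩
    G * (ιₙ (suc (S ℕ.+ m)) * (F₁ * I))       ≈⟨ *-congˡ (sym (*-assoc _ _ _)) ⟩
    G * ((ιₙ (suc (S ℕ.+ m)) * F₁) * I)       ≈⟨ *-congˡ (*-congʳ (ιₙ*invFact∸-suc S m (length λ′))) ⟩
    G * ((F₀ + ιₙ (S ℕ.+ length λ′) * F₁) * I) ≈⟨ *-congˡ (distribʳ _ _ _) ⟩
    G * (F₀ * I + (ιₙ (S ℕ.+ length λ′) * F₁) * I) ≈⟨ distribˡ _ _ _ ⟩
    G * (F₀ * I) + G * ((ιₙ (S ℕ.+ length λ′) * F₁) * I)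
      ≈⟨ +-congˡ (trans (*-congˡ (*-assoc _ _ _)) (x∙yz≈y∙xz _ _ _)) ⟩
    term m λ′ + ιₙ (S ℕ.+ length λ′) * term (suc m) λ′ ∎
    where
    G  = 𝒢 R ι g λ′
    I  = ι (invProd λ′)
    F₀ = invFact∸ m (length λ′)
    F₁ = invFact∸ (suc m) (length λ′)

  -- Removing the last part a of λ′ = μ ++ [ a ] removes exactly the factor (|λ′| + ℓ(λ′))⁻¹ from the product.
  term-∷ʳ : ∀ m μ a → ιₙ (sum (μ ++ [ a ]) ℕ.+ length (μ ++ [ a ])) * term (suc m) (μ ++ [ a ]) ≈ g (a ℕ.+ 1) * term m μ
  term-∷ʳ m μ a = begin
    ιₙ (sum (μ ++ [ a ]) ℕ.+ length (μ ++ [ a ])) * term (suc m) (μ ++ [ a ])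
      ≈⟨ *-cong (reflexive (≡.cong ιₙ size)) (*-cong (𝒢-∷ʳ μ a) (*-cong invFact∸-∷ʳ (ι-invProd-∷ʳ μ a))) ⟩
    ιₙ (suc k) * ((G * g′) * (F * (I * invSuc k)))   ≈⟨ x∙yz≈y∙xz _ _ _ ⟩
    (G * g′) * (ιₙ (suc k) * (F * (I * invSuc k)))   ≈⟨ *-congˡ (*-congˡ (sym (*-assoc _ _ _))) ⟩
    (G * g′) * (ιₙ (suc k) * ((F * I) * invSuc k))   ≈⟨ *-congˡ (x∙yz≈y∙xz _ _ _) ⟩
    (G * g′) * ((F * I) * (ιₙ (suc k) * invSuc k))   ≈⟨ *-congˡ (trans (*-congˡ (ιₙ-suc*invSuc k)) (*-identityʳ _)) ⟩
    (G * g′) * (F * I)                               ≈⟨ *-congʳ (*-comm G g′) ⟩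
    (g′ * G) * (F * I)                               ≈⟨ *-assoc _ _ _ ⟩
    g′ * term m μ                                    ∎
    where
    G  = 𝒢 R ι g μ
    g′ = g (a ℕ.+ 1)
    F  = invFact∸ m (length μ)
    I  = ι (invProd μ)
    k  = length μ ℕ.+ (sum μ ℕ.+ a)
    length-∷ʳ : length (μ ++ [ a ]) ≡ suc (length μ)
    length-∷ʳ = ≡.trans (length-++ μ) (ℕP.+-comm (length μ) 1)
    invFact∸-∷ʳ : invFact∸ (suc m) (length (μ ++ [ a ])) ≈ F
    invFact∸-∷ʳ = trans (reflexive (≡.cong (invFact∸ (suc m)) length-∷ʳ)) (invFact∸-suc m (length μ))
    size : sum (μ ++ [ a ]) ℕ.+ length (μ ++ [ a ]) ≡ suc k
    size = ≡.trans (≡.cong₂ ℕ._+_ (≡.trans (sum-++ μ [ a ]) (≡.cong (sum μ ℕ.+_) (ℕP.+-identityʳ a))) length-∷ʳ)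
             (≡.trans (ℕP.+-suc (sum μ ℕ.+ a) (length μ)) (≡.cong suc (ℕP.+-comm (sum μ ℕ.+ a) (length μ))))

  ∑-size*term : ∀ m N → ∑ (compositions N) (λ λ′ → ιₙ (sum λ′ ℕ.+ length λ′) * term (suc m) λ′) ≈
                         ∑< N (λ i → g (2 ℕ.+ i) * compositionSum m (N ∸ suc i))
  ∑-size*term m zero = trans (+-identityʳ _) (trans (*-congʳ ι.0#-homo) (zeroˡ _))
  ∑-size*term m (suc N) = trans (∑-compositions-last N _) (∑<-cong (suc N) λ i _ → begin
    ∑ (compositions (N ∸ i)) (λ μ → ιₙ (sum (μ ++ [ suc i ]) ℕ.+ length (μ ++ [ suc i ])) * term (suc m) (μ ++ [ suc i ]))
      ≈⟨ ∑-cong (compositions (N ∸ i)) (λ μ →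
           trans (term-∷ʳ m μ (suc i)) (*-congʳ (reflexive (≡.cong (g ∘ suc) (ℕP.+-comm i 1))))) ⟩
    ∑ (compositions (N ∸ i)) (λ μ → g (2 ℕ.+ i) * term m μ)
      ≈⟨ *-distribˡ-∑ (g (2 ℕ.+ i)) (compositions (N ∸ i)) ⟨
    g (2 ℕ.+ i) * compositionSum m (N ∸ i) ∎)

  compositionSum-suc : ∀ m N → ιₙ (suc (N ℕ.+ m)) * compositionSum (suc m) N ≈
                               compositionSum m N + ∑< N (λ i → g (2 ℕ.+ i) * compositionSum m (N ∸ suc i))
  compositionSum-suc m N = begin
    ιₙ (suc (N ℕ.+ m)) * compositionSum (suc m) N
      ≈⟨ *-distribˡ-∑ _ (compositions N) ⟩
    ∑ (compositions N) (λ λ′ → ιₙ (suc (N ℕ.+ m)) * term (suc m) λ′)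
      ≈⟨ ∑-compsF-cong N N (λ λ′ (_ , Σλ′) → trans
           (reflexive (≡.cong (λ S → ιₙ (suc (S ℕ.+ m)) * term (suc m) λ′) (≡.sym Σλ′)))
           (term-suc (sum λ′) m λ′)) ⟩
    ∑ (compositions N) (λ λ′ → term m λ′ + ιₙ (sum λ′ ℕ.+ length λ′) * term (suc m) λ′)
      ≈⟨ ∑-+ (compositions N) ⟩
    compositionSum m N + ∑ (compositions N) (λ λ′ → ιₙ (sum λ′ ℕ.+ length λ′) * term (suc m) λ′)
      ≈⟨ +-congˡ (∑-size*term m N) ⟩
    compositionSum m N + ∑< N (λ i → g (2 ℕ.+ i) * compositionSum m (N ∸ suc i)) ∎

  P : ℕ → ℕ → Carrier
  P = Pcoeff R ι g

  table-sum : ∀ (f : ℕ → ℕ) n m →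
              sumR R ι (zipWith (λ k p → g k * p m) (map suc (applyUpTo f (suc n))) (table R ι g n)) ≡
              ∑< (suc n) (λ i → g (suc (f i)) * P (n ∸ i) m)
  table-sum f zero    m = ≡.refl
  table-sum f (suc n) m = ≡.cong (_+_ _) (table-sum (f ∘ suc) n m)

  P-suc : ∀ n m → P (suc n) (suc m) ≈ invSuc n * ∑< (suc n) (λ i → g (suc i) * P (n ∸ i) m)
  P-suc n m = *-congˡ (reflexive (table-sum id n m))

  P-vanishes : ∀ m n → n < m → P n m ≈ 0#
  P-vanishes (suc m) zero    _         = refl
  P-vanishes (suc m) (suc n) (s≤s n<m) = begin
    P (suc n) (suc m)                                       ≈⟨ P-suc n m ⟩
    invSuc n * ∑< (suc n) (λ i → g (suc i) * P (n ∸ i) m)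
      ≈⟨ *-congˡ (∑<-zero (suc n) {λ i → g (suc i) * P (n ∸ i) m} (λ i _ →
           trans (*-congˡ (P-vanishes m (n ∸ i) (ℕP.≤-<-trans (ℕP.m∸n≤m n i) n<m))) (zeroʳ _))) ⟩
    invSuc n * 0#                                           ≈⟨ zeroʳ _ ⟩
    0#                                                      ∎

  -- Induction on m: the recursion for P (N + m + 1) (m + 1) only involves coefficients of x^m.
  P≈compositionSum : g 1 ≈ 1# → ∀ m N → P (N ℕ.+ m) m ≈ compositionSum m N
  P≈compositionSum g1≈1 zero N rewrite ℕP.+-identityʳ N = base N
    where
    base : ∀ N → P N 0 ≈ compositionSum 0 N
    base zero    = sym (trans (+-identityʳ _) (trans (*-identityˡ _) (trans (*-identityˡ _) ι.1#-homo)))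
    base (suc N) = sym (trans (∑-compsF-cong (suc N) (suc N) {G = λ _ → 0#} λ
      { [] (_ , ())
      ; (_ ∷ _) _ → trans (*-congˡ (zeroˡ _)) (zeroʳ _) })
      (∑-zero (compositions (suc N)) (λ _ → refl)))
  P≈compositionSum g1≈1 (suc m) N rewrite ℕP.+-suc N m = begin
    P (suc (N ℕ.+ m)) (suc m)
      ≈⟨ P-suc (N ℕ.+ m) m ⟩
    invSuc (N ℕ.+ m) * ∑< (suc N ℕ.+ m) h
      ≈⟨ *-congˡ (∑<-+ (suc N) m {h}) ⟩
    invSuc (N ℕ.+ m) * (∑< (suc N) h + ∑< m (λ i → h (suc N ℕ.+ i)))
      ≈⟨ *-congˡ (+-cong (+-cong head tail) vanishing) ⟩
    invSuc (N ℕ.+ m) * ((compositionSum m N + ∑< N (λ i → g (2 ℕ.+ i) * compositionSum m (N ∸ suc i))) + 0#)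
      ≈⟨ *-congˡ (trans (+-identityʳ _) (sym (compositionSum-suc m N))) ⟩
    invSuc (N ℕ.+ m) * (ιₙ (suc (N ℕ.+ m)) * compositionSum (suc m) N)
      ≈⟨ trans (sym (*-assoc _ _ _)) (*-congʳ (trans (*-comm _ _) (ιₙ-suc*invSuc (N ℕ.+ m)))) ⟩
    1# * compositionSum (suc m) N
      ≈⟨ *-identityˡ _ ⟩
    compositionSum (suc m) N ∎
    where
    h : ℕ → Carrier
    h i = g (suc i) * P ((N ℕ.+ m) ∸ i) m
    head : h 0 ≈ compositionSum m N
    head = trans (*-cong g1≈1 (P≈compositionSum g1≈1 m N)) (*-identityˡ _)
    tail : ∑< N (h ∘ suc) ≈ ∑< N (λ i → g (2 ℕ.+ i) * compositionSum m (N ∸ suc i))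
    tail = ∑<-cong N (λ i i<N → *-congˡ (trans
      (reflexive (≡.cong (λ k → P k m) (ℕP.+-∸-comm m i<N)))
      (P≈compositionSum g1≈1 m (N ∸ suc i))))
    vanishing : ∑< m (λ i → h (suc N ℕ.+ i)) ≈ 0#
    vanishing = ∑<-zero m (λ i i<m → trans (*-congˡ (P-vanishes m _ ([n+m]∸[1+n+i]<m N i<m))) (zeroʳ _))

  orbitTerm : ℕ → List ℕ → Carrier
  orbitTerm n λ′ = 𝒢 R ι g λ′ * (ι (ℤtoℚ (fallingℤ n (sum λ′ ℕ.+ length λ′))) * ι (invProd λ′))

  A≈∑orbitTerm : g 1 ≈ 1# → ∀ m N → A R ι g (N ℕ.+ m) m ≈ ∑ (compositions N) (orbitTerm (N ℕ.+ m))
  A≈∑orbitTerm g1≈1 m N = begin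
    ιₙ ((N ℕ.+ m) !) * P (N ℕ.+ m) m                        ≈⟨ *-congˡ (P≈compositionSum g1≈1 m N) ⟩
    ιₙ ((N ℕ.+ m) !) * compositionSum m N                   ≈⟨ *-distribˡ-∑ _ (compositions N) ⟩
    ∑ (compositions N) (λ λ′ → ιₙ ((N ℕ.+ m) !) * term m λ′) ≈⟨ ∑-compsF-cong N N (λ λ′ (_ , Σλ′) → begin
      ιₙ ((N ℕ.+ m) !) * term m λ′
        ≈⟨ trans (x∙yz≈y∙xz _ _ _) (*-congˡ (sym (*-assoc _ _ _))) ⟩
      𝒢 R ι g λ′ * ((ιₙ ((N ℕ.+ m) !) * invFact∸ m (length λ′)) * ι (invProd λ′))
        ≈⟨ *-congˡ (*-congʳ (ιₙ-!*invFact∸ N m (length λ′))) ⟩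
      𝒢 R ι g λ′ * (ι (ℤtoℚ (fallingℤ (N ℕ.+ m) (N ℕ.+ length λ′))) * ι (invProd λ′))
        ≡⟨ ≡.cong (λ S → 𝒢 R ι g λ′ * (ι (ℤtoℚ (fallingℤ (N ℕ.+ m) (S ℕ.+ length λ′))) * ι (invProd λ′)))
                  (≡.sym Σλ′) ⟩
      orbitTerm (N ℕ.+ m) λ′ ∎) ⟩
    ∑ (compositions N) (orbitTerm (N ℕ.+ m))                ∎

  orbitSum≈∑orbitTerm : ∀ n μ →
    𝒢 R ι g μ * ι (ℤtoℚ (fallingℤ n (sum μ ℕ.+ length μ)) ℚ.* sumℚ (map invProd (Orb μ))) ≈ ∑ (Orb μ) (orbitTerm n)
  orbitSum≈∑orbitTerm n μ = begin
    G μ * ι (falling μ ℚ.* sumℚ (map invProd (Orb μ)))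
      ≈⟨ *-congˡ (trans (ι.*-homo _ _)
           (*-congˡ (trans (ι-sumℚ (map invProd (Orb μ))) (reflexive (∑-map invProd (Orb μ) {ι}))))) ⟩
    G μ * (ι (falling μ) * ∑ (Orb μ) (ι ∘ invProd))
      ≈⟨ trans (*-congˡ (*-distribˡ-∑ _ (Orb μ))) (*-distribˡ-∑ _ (Orb μ)) ⟩
    ∑ (Orb μ) (λ λ′ → G μ * (ι (falling μ) * ι (invProd λ′)))
      ≈⟨ ∑-filter-cong (λ λ′ → isPermᵇ λ′ μ) (compositions (sum μ)) (λ λ′ λ′∼μ →
           let λ′↭μ = isPermᵇ⇒↭ λ′ μ λ′∼μ in
           *-cong (sym (𝒢-↭ λ′↭μ)) (*-congʳ (reflexive (≡.cong (ι ∘ ℤtoℚ ∘ fallingℤ n)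
             (≡.sym (≡.cong₂ ℕ._+_ (sum-↭ λ′↭μ) (↭-length λ′↭μ))))))) ⟩
    ∑ (Orb μ) (orbitTerm n) ∎
    where
    G = 𝒢 R ι g
    falling : List ℕ → ℚ
    falling λ′ = ℤtoℚ (fallingℤ n (sum λ′ ℕ.+ length λ′))

theorem2 : {c ℓ : Level} (R : CommutativeRing c ℓ) (ι : ℚ → CommutativeRing.Carrier R)
    → RingMorphisms.IsRingHomomorphism +-*-rawRing (CommutativeRing.rawRing R) ι
    → (g : ℕ → CommutativeRing.Carrier R)
    → CommutativeRing._≈_ R (g 1) (CommutativeRing.1# R)
    → (n m : ℕ) → 1 ≤ m → m < n
    → CommutativeRing._≈_ R (A R ι g n m) (RHS R ι g n m)
-- The formula also holds for m = 0.
theorem2 R ι hom g g1≈1 n m _ m<n = begin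
  A R ι g n m                                       ≈⟨ A≈∑compositions ⟩
  ∑ (compositions N) (orbitTerm n)                  ≈⟨ ∑-partitions-Orb N (orbitTerm n) ⟨
  ∑ (partitions N) (λ μ → ∑ (Orb μ) (orbitTerm n))  ≈⟨ ∑-cong (partitions N) (orbitSum≈∑orbitTerm n) ⟨
  RHS R ι g n m                                     ∎
  where
  open CommutativeRing R
  open FiniteSums commutativeSemiring
  open CompositionSums commutativeSemiring
  open CoefficientFormula R ι hom g
  open import Relation.Binary.Reasoning.Setoid setoid
  N = n ∸ m
  N+m≡n : N ℕ.+ m ≡ n
  N+m≡n = ℕP.m∸n+n≡m (ℕP.<⇒≤ m<n)
  A≈∑compositions : A R ι g n m ≈ ∑ (compositions N) (orbitTerm n)
  A≈∑compositions = ≡.subst (λ k → A R ι g k m ≈ ∑ (compositions N) (orbitTerm k)) N+m≡n (A≈∑orbitTerm g1≈1 m N)
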